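{- Let $A$ be a c.e. set, let $\mathcal{G}$ be a collection of c.e. sets, and let $R_0,R_1,\dots$ be computable sets such that $\{R_0,R_1,\dots\}\cup\mathcal{G}$ generates $\mathcal{D}(A)$. Then there is a collection $\{\tilde R_0,\tilde R_1,\dots\}$ of pairwise disjoint computable sets such that $\{\tilde R_0,\tilde R_1,\dots\}\cup\mathcal{G}$ generates $\mathcal{D}(A)$.
   Context: All sets are c.e. subsets of $\omega$. $X\subseteq^*Y$ means $X-Y$ is finite. A (possibly finite or empty) collection $\mathcal{H}$ of c.e. sets generates $\mathcal{D}(A)$ if every member of $\mathcal{H}$ is disjoint from $A$ and every c.e. set disjoint from $A$ is $\subseteq^*$ the union of finitely many members of $\mathcal{H}$. -}

module Defs where

open import Data.Nat using (ℕ; zero; suc; _<_)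
open import Data.Fin using (Fin)
open import Data.Vec using (Vec; []; _∷_; lookup)
open import Data.List using (List)
open import Data.List.Membership.Propositional using (_∈_)
open import Data.List.Relation.Unary.Any using (Any)
open import Data.Product using (Σ; ∃; _×_)
open import Data.Sum using (_⊎_; inj₁; inj₂)
open import Data.Empty using (⊥)
open import Relation.Nullary using (¬_)
open import Relation.Binary.PropositionalEquality using (_≡_)

data PR : ℕ → Set where
  Z : ∀ {n} → PR n
  S : PR 1
  P : ∀ {n} → Fin n → PR n
  C : ∀ {m n} → PR m → Vec (PR n) m → PR n
  R : ∀ {n} → PR n → PR (suc (suc n)) → PR (suc n)
  M : ∀ {n} → PR (suc n) → PR n

mutual
  data _[_]⇓_ : ∀ {n} → PR n → Vec ℕ n → ℕ → Set where
    evZ : ∀ {n} {xs : Vec ℕ n} → Z [ xs ]⇓ 0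
    evS : ∀ {x} → S [ x ∷ [] ]⇓ suc x
    evP : ∀ {n} {i : Fin n} {xs} → P i [ xs ]⇓ lookup xs i
    evC : ∀ {m n} {f : PR m} {gs : Vec (PR n) m} {xs ys y} →
          gs [ xs ]⇓* ys → f [ ys ]⇓ y → C f gs [ xs ]⇓ y
    evR0 : ∀ {n} {f : PR n} {g xs y} →
           f [ xs ]⇓ y → R f g [ 0 ∷ xs ]⇓ y
    evRs : ∀ {n} {f : PR n} {g xs k r y} →
           R f g [ k ∷ xs ]⇓ r → g [ k ∷ r ∷ xs ]⇓ y → R f g [ suc k ∷ xs ]⇓ y
    evM : ∀ {n} {f : PR (suc n)} {xs y} →
          f [ y ∷ xs ]⇓ 0 →
          (∀ z → z < y → ∃ λ k → f [ z ∷ xs ]⇓ suc k) →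
          M f [ xs ]⇓ y

  data _[_]⇓*_ : ∀ {m n} → Vec (PR n) m → Vec ℕ n → Vec ℕ m → Set where
    ev[] : ∀ {n} {xs : Vec ℕ n} → [] [ xs ]⇓* []
    ev∷ : ∀ {m n} {g : PR n} {gs : Vec (PR n) m} {xs y ys} →
          g [ xs ]⇓ y → gs [ xs ]⇓* ys → (g ∷ gs) [ xs ]⇓* (y ∷ ys)

SetN : Set₁
SetN = ℕ → Set

CE : SetN → Set
CE X = Σ (PR 1) λ f → ∀ n → (X n → ∃ λ y → f [ n ∷ [] ]⇓ y)
                          × ((∃ λ y → f [ n ∷ [] ]⇓ y) → X n)

Computable : SetN → Set
Computable X = Σ (PR 1) λ f → ∀ n →
  (f [ n ∷ [] ]⇓ 1 × X n) ⊎ (f [ n ∷ [] ]⇓ 0 × ¬ X n)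

Disjoint : SetN → SetN → Set
Disjoint X Y = ∀ n → X n → Y n → ⊥

Finite : SetN → Set
Finite X = Σ (List ℕ) λ l → ∀ n → X n → n ∈ l

_⊆*_ : SetN → SetN → Set
X ⊆* Y = Finite (λ n → X n × ¬ Y n)

⋃ : ∀ {J : Set} → (J → SetN) → List J → SetN
⋃ H js n = Any (λ j → H j n) js

Generates : ∀ {J : Set} → (J → SetN) → SetN → Set₁
Generates {J} H A =
  (∀ j → Disjoint (H j) A) ×
  (∀ (W : SetN) → CE W → Disjoint W A → Σ (List J) λ js → W ⊆* ⋃ H js)

_⊕_ : ∀ {I : Set} → (ℕ → SetN) → (I → SetN) → (ℕ ⊎ I → SetN)
(Rs ⊕ G) (inj₁ n) = Rs n
(Rs ⊕ G) (inj₂ i) = G i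

-- Idea: replace R₀, R₁, … by the differences  R̃ₙ = Rₙ − (R₀ ∪ … ∪ Rₙ₋₁).
-- These are computable (Boolean combinations of computable sets), pairwise
-- disjoint, R̃ₙ ⊆ Rₙ (so they stay disjoint from A), and every Rₖ is covered
-- by R̃₀ ∪ … ∪ R̃ₖ.  Hence a finite union of members of {Rₙ} ∪ 𝒢 is covered
-- by a finite union of members of {R̃ₙ} ∪ 𝒢, so the new family still
-- generates 𝒟(A).
module Submission where

open import Defs
open import Data.Nat using (ℕ; zero; suc; _<_; s≤s)
open import Data.Nat.Properties using (<-cmp; m≤n⇒m<n∨m≡n)
open import Data.Fin using () renaming (zero to fzero; suc to fsuc)
open import Data.Vec using ([]; _∷_)
open import Data.List using (List; []; _∷_; map; concatMap; downFrom)
open import Data.List.Relation.Unary.Any using (here; there)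
  renaming (map to any-map)
open import Data.List.Relation.Unary.Any.Properties using (map⁺; concat⁺)
open import Data.Product using (Σ; _×_; _,_; proj₁; proj₂)
open import Data.Sum using (_⊎_; inj₁; inj₂)
open import Data.Empty using (⊥)
open import Relation.Nullary using (¬_; Dec; yes; no)
open import Relation.Binary using (tri<; tri≈; tri>)
open import Relation.Binary.PropositionalEquality using (_≡_; refl)

Verdict : ℕ → Set → Set
Verdict b X = (b ≡ 1 × X) ⊎ (b ≡ 0 × ¬ X)

Realizes : PR 2 → (Set → Set → Set) → Set₁
Realizes op _∙_ = ∀ {b c X Y} → Verdict b X → Verdict c Y →
  Σ ℕ λ d → op [ b ∷ c ∷ [] ]⇓ d × Verdict d (X ∙ Y)

combine : ∀ {op _∙_ X Y} → Realizes op _∙_ →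
  Computable X → Computable Y → Computable (λ n → X n ∙ Y n)
combine {op} {_∙_} realizes (f , decideX) (g , decideY) =
  C op (f ∷ g ∷ []) , λ n → decision (verdict (decideX n)) (verdict (decideY n))
  where
  verdict : ∀ {h : PR 1} {n Z} → (h [ n ∷ [] ]⇓ 1 × Z) ⊎ (h [ n ∷ [] ]⇓ 0 × ¬ Z) →
    Σ ℕ λ b → h [ n ∷ [] ]⇓ b × Verdict b Z
  verdict (inj₁ (ev , z)) = 1 , ev , inj₁ (refl , z)
  verdict (inj₂ (ev , ¬z)) = 0 , ev , inj₂ (refl , ¬z)

  decision : ∀ {n X′ Y′} →
    Σ ℕ (λ b → f [ n ∷ [] ]⇓ b × Verdict b X′) →
    Σ ℕ (λ c → g [ n ∷ [] ]⇓ c × Verdict c Y′) →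
    (C op (f ∷ g ∷ []) [ n ∷ [] ]⇓ 1 × (X′ ∙ Y′)) ⊎
    (C op (f ∷ g ∷ []) [ n ∷ [] ]⇓ 0 × ¬ (X′ ∙ Y′))
  decision (b , evf , vX) (c , evg , vY) with realizes vX vY
  ... | d , evOp , inj₁ (refl , xy) = inj₁ (evC (ev∷ evf (ev∷ evg ev[])) evOp , xy)
  ... | d , evOp , inj₂ (refl , ¬xy) = inj₂ (evC (ev∷ evf (ev∷ evg ev[])) evOp , ¬xy)

-- Boolean negation: ¬0 = 1 and ¬(k+1) = 0, by primitive recursion.
negation : PR 1
negation = R (C S (Z ∷ [])) Z

negation-0 : negation [ 0 ∷ [] ]⇓ 1
negation-0 = evR0 (evC (ev∷ evZ ev[]) evS)

negation-1 : negation [ 1 ∷ [] ]⇓ 0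
negation-1 = evRs negation-0 evZ

-- Disjunction by recursion on the first argument: 0 ∨ c = c, 1 ∨ c = 1.
disjunction : PR 2
disjunction = R (P fzero) (C S (Z ∷ []))

disjunction-realizes : Realizes disjunction _⊎_
disjunction-realizes (inj₁ (refl , x)) _ =
  1 , evRs (evR0 evP) (evC (ev∷ evZ ev[]) evS) , inj₁ (refl , inj₁ x)
disjunction-realizes (inj₂ (refl , ¬x)) (inj₁ (refl , y)) =
  1 , evR0 evP , inj₁ (refl , inj₂ y)
disjunction-realizes (inj₂ (refl , ¬x)) (inj₂ (refl , ¬y)) =
  0 , evR0 evP , inj₂ (refl , λ { (inj₁ x) → ¬x x ; (inj₂ y) → ¬y y })

-- Difference by recursion on the first argument: 0 ∧ ¬c = 0, 1 ∧ ¬c = ¬c.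
difference : PR 2
difference = R Z (C negation (P (fsuc (fsuc fzero)) ∷ []))

difference-realizes : Realizes difference (λ X Y → X × ¬ Y)
difference-realizes (inj₂ (refl , ¬x)) _ =
  0 , evR0 evZ , inj₂ (refl , λ xy → ¬x (proj₁ xy))
difference-realizes (inj₁ (refl , x)) (inj₁ (refl , y)) =
  0 , evRs (evR0 evZ) (evC (ev∷ evP ev[]) negation-1) , inj₂ (refl , λ xy → proj₂ xy y)
difference-realizes (inj₁ (refl , x)) (inj₂ (refl , ¬y)) =
  1 , evRs (evR0 evZ) (evC (ev∷ evP ev[]) negation-0) , inj₁ (refl , x , ¬y)

∅-computable : Computable (λ _ → ⊥)
∅-computable = Z , λ _ → inj₂ (evZ , λ ())

decide : ∀ {X} → Computable X → ∀ n → Dec (X n)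
decide (_ , decideX) n with decideX n
... | inj₁ (_ , x) = yes x
... | inj₂ (_ , ¬x) = no ¬x

⊆*-weaken : ∀ {X Y Z : SetN} → X ⊆* Y → (∀ n → Y n → Z n) → X ⊆* Z
⊆*-weaken (exceptions , listed) Y⊆Z =
  exceptions , λ n xz → listed n (proj₁ xz , λ y → proj₂ xz (Y⊆Z n y))

module Refinement {J J′ : Set} (H : J → SetN) (H′ : J′ → SetN)
  (cover : J → List J′) (covers : ∀ j {n} → H j n → ⋃ H′ (cover j) n) where

  ⋃-refine : ∀ js {n} → ⋃ H js n → ⋃ H′ (concatMap cover js) n
  ⋃-refine js p = concat⁺ (map⁺ (any-map (λ {j} → covers j) p))

  refine-generates : ∀ {A} → (∀ j′ → Disjoint (H′ j′) A) →
    Generates H A → Generates H′ A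
  refine-generates H′-disjoint (_ , generate) =
    H′-disjoint , λ W ceW W-disjoint →
      let (js , W⊆*⋃H) = generate W ceW W-disjoint
      in concatMap cover js , ⊆*-weaken W⊆*⋃H (λ n → ⋃-refine js)

⊕-cover : ∀ {I : Set} → (ℕ → List ℕ) → ℕ ⊎ I → List (ℕ ⊎ I)
⊕-cover cover (inj₁ k) = map inj₁ (cover k)
⊕-cover cover (inj₂ i) = inj₂ i ∷ []

⊕-covers : ∀ {I : Set} {Rs Rs′ : ℕ → SetN} (G : I → SetN) (cover : ℕ → List ℕ) →
  (∀ k {n} → Rs k n → ⋃ Rs′ (cover k) n) →
  ∀ j {n} → (Rs ⊕ G) j n → ⋃ (Rs′ ⊕ G) (⊕-cover cover j) n
⊕-covers G cover covers (inj₁ k) r = map⁺ (covers k r)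
⊕-covers G cover covers (inj₂ i) g = here g

module Disjointification (Rs : ℕ → SetN) (Rs-computable : ∀ n → Computable (Rs n)) where

  Before : ℕ → SetN
  Before zero _ = ⊥
  Before (suc n) x = Before n x ⊎ Rs n x

  Before-computable : ∀ n → Computable (Before n)
  Before-computable zero = ∅-computable
  Before-computable (suc n) =
    combine disjunction-realizes (Before-computable n) (Rs-computable n)

  R̃ : ℕ → SetN
  R̃ n x = Rs n x × ¬ Before n x

  R̃-computable : ∀ n → Computable (R̃ n)
  R̃-computable n =
    combine difference-realizes (Rs-computable n) (Before-computable n)

  R̃⊆Rs : ∀ n {x} → R̃ n x → Rs n x
  R̃⊆Rs n = proj₁

  Rs⊆Before : ∀ {k n x} → k < n → Rs k x → Before n x
  Rs⊆Before {k} {suc n} (s≤s k≤n) r with m≤n⇒m<n∨m≡n k≤n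
  ... | inj₁ k<n = inj₁ (Rs⊆Before k<n r)
  ... | inj₂ refl = inj₂ r

  -- A point of R̃ₘ ∩ R̃ₙ with m < n lies in Rₘ ⊆ R₀ ∪ … ∪ Rₙ₋₁, contradicting R̃ₙ.
  R̃-disjoint : ∀ m n → ¬ m ≡ n → Disjoint (R̃ m) (R̃ n)
  R̃-disjoint m n m≢n x (rm , ¬before-m) (rn , ¬before-n) with <-cmp m n
  ... | tri< m<n _ _ = ¬before-n (Rs⊆Before m<n rm)
  ... | tri≈ _ m≡n _ = m≢n m≡n
  ... | tri> _ _ n<m = ¬before-m (Rs⊆Before n<m rn)

  -- R₀ ∪ … ∪ Rₙ₋₁ = R̃₀ ∪ … ∪ R̃ₙ₋₁: a point of the union lies in R̃ⱼ for the
  -- least j with x ∈ Rⱼ, found by deciding membership in the shorter unions.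
  Before⊆⋃R̃ : ∀ n {x} → Before n x → ⋃ R̃ (downFrom n) x
  Before⊆⋃R̃ (suc n) {x} before with decide (Before-computable n) x | before
  ... | yes before-n | _ = there (Before⊆⋃R̃ n before-n)
  ... | no ¬before-n | inj₁ before-n = there (Before⊆⋃R̃ n before-n)
  ... | no ¬before-n | inj₂ r = here (r , ¬before-n)

  Rs⊆⋃R̃ : ∀ k {x} → Rs k x → ⋃ R̃ (downFrom (suc k)) x
  Rs⊆⋃R̃ k r = Before⊆⋃R̃ (suc k) (inj₂ r)

lemma3p5 : (A : SetN) → CE A → (I : Set) → (G : I → SetN) → (∀ i → CE (G i)) →
    (Rs : ℕ → SetN) → (∀ n → Computable (Rs n)) → Generates (Rs ⊕ G) A →
    Σ (ℕ → SetN) λ Rt → (∀ n → Computable (Rt n)) ×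
    (∀ m n → ¬ m ≡ n → Disjoint (Rt m) (Rt n)) × Generates (Rt ⊕ G) A
lemma3p5 A _ I G _ Rs Rs-computable generates@(disjoint , _) =
  R̃ , R̃-computable , R̃-disjoint , refine-generates R̃⊕G-disjoint generates
  where
  open Disjointification Rs Rs-computable
  open Refinement (Rs ⊕ G) (R̃ ⊕ G) (⊕-cover (λ k → downFrom (suc k)))
                  (⊕-covers G (λ k → downFrom (suc k)) Rs⊆⋃R̃)

  -- R̃ₙ ⊆ Rₙ, so the new family is still disjoint from A.
  R̃⊕G-disjoint : ∀ j → Disjoint ((R̃ ⊕ G) j) A
  R̃⊕G-disjoint (inj₁ n) x r̃ = disjoint (inj₁ n) x (R̃⊆Rs n r̃)
  R̃⊕G-disjoint (inj₂ i) = disjoint (inj₂ i)
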